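{- Let $k\ge 0$ be an integer and let $G$ be a directed star on $2k+1$ vertices with central vertex $v$ whose in-degree and out-degree are both $k$. Then $(\{v\},G)$ is strongly tournament anti-Sidorenko.
   Context: All digraphs are oriented graphs (no loops, no antiparallel edges). A tournament is an orientation of a complete graph without loops. A labeled copy of a digraph $D$ in $T$ is an injective map $\varphi:V(D)\to V(T)$ with $(\varphi(x),\varphi(y))\in E(T)$ whenever $(x,y)\in E(D)$. For a digraph $D$ and an independent set $I\subseteq V(D)$, the pair $(I,D)$ is strongly tournament anti-Sidorenko if for every $n$, every $n$-vertex tournament $T$ and every injective map $\phi:I\to V(T)$, the number of labeled copies $\varphi$ of $D$ in $T$ with $\varphi|_I=\phi$ is at most $2^{ -e(D)}n^{v(D)-|I|}$. -}

module Defs where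

open import Data.Nat using (ℕ; zero; suc; _+_; _*_; _∸_; _^_; _≤_; _<ᵇ_)
open import Data.Bool using (Bool; true; false; not; _∧_; _∨_; if_then_else_; T)
open import Data.Bool.Properties using (T?)
open import Data.Fin using (Fin; toℕ) renaming (zero to fzero; suc to fsuc)
import Data.Fin as Fin
open import Data.List using (List; []; _∷_; map; concatMap; filter; length; allFin; foldr)
open import Data.Nat.ListAction using (sum)
open import Data.Vec using (Vec; lookup) renaming ([] to []ᵛ; _∷_ to _∷ᵛ_)
open import Relation.Nullary.Decidable using (⌊_⌋)
open import Relation.Binary.PropositionalEquality using (_≡_; _≢_)

allᵇ : ∀ {n} → (Fin n → Bool) → Bool
allᵇ {n} p = foldr (λ i b → p i ∧ b) true (allFin n)

countᵇ : ∀ {n} → (Fin n → Bool) → ℕ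
countᵇ {n} p = length (filter (λ i → T? (p i)) (allFin n))

_==_ : ∀ {n} → Fin n → Fin n → Bool
x == y = ⌊ x Fin.≟ y ⌋

_⇒ᵇ_ : Bool → Bool → Bool
a ⇒ᵇ b = not a ∨ b

record Digraph : Set where
  field
    size   : ℕ
    adj    : Fin size → Fin size → Bool
    noLoop : ∀ x → adj x x ≡ false
    noAnti : ∀ x y → adj x y ≡ true → adj y x ≡ false
open Digraph public

v : Digraph → ℕ
v D = size D

e : Digraph → ℕ
e D = sum (map (λ x → countᵇ (adj D x)) (allFin (size D)))

record Tournament (n : ℕ) : Set where
  field
    arc      : Fin n → Fin n → Bool
    irrefl   : ∀ x → arc x x ≡ false
    complete : ∀ x y → x ≢ y → arc x y ≡ not (arc y x)
open Tournament public

Subset : ℕ → Set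
Subset m = Fin m → Bool

∣_∣ : ∀ {m} → Subset m → ℕ
∣ I ∣ = countᵇ I

IsIndependent : (D : Digraph) → Subset (size D) → Set
IsIndependent D I = ∀ x y → I x ≡ true → I y ≡ true → adj D x y ≡ false

allMaps : (m n : ℕ) → List (Vec (Fin n) m)
allMaps zero    n = []ᵛ ∷ []
allMaps (suc m) n = concatMap (λ x → map (x ∷ᵛ_) (allMaps m n)) (allFin n)

injectiveOnᵇ : ∀ {m n} → Subset m → (Fin m → Fin n) → Bool
injectiveOnᵇ S f =
  allᵇ (λ x → allᵇ (λ y → (S x ∧ S y ∧ (f x == f y)) ⇒ᵇ (x == y)))

-- injective map φ : I → V(T), represented by a total map Fin m → Fin n
-- of which only the values on I matter
InjectiveOn : ∀ {m n} → Subset m → (Fin m → Fin n) → Set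
InjectiveOn S f = ∀ x y → S x ≡ true → S y ≡ true → f x ≡ f y → x ≡ y

isExtCopyᵇ : (D : Digraph) {n : ℕ} → Tournament n → Subset (size D)
           → (Fin (size D) → Fin n) → (Fin (size D) → Fin n) → Bool
isExtCopyᵇ D T I ϕ φ =
  injectiveOnᵇ (λ _ → true) φ
  ∧ allᵇ (λ x → allᵇ (λ y → adj D x y ⇒ᵇ arc T (φ x) (φ y)))
  ∧ allᵇ (λ x → I x ⇒ᵇ (φ x == ϕ x))

extCopies : (D : Digraph) {n : ℕ} → Tournament n → Subset (size D)
          → (Fin (size D) → Fin n) → ℕ
extCopies D {n} T I ϕ =
  length (filter (λ φ → T? (isExtCopyᵇ D T I ϕ (lookup φ))) (allMaps (size D) n))

-- (I , D) is strongly tournament anti-Sidorenko: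
--   #copies ≤ 2^{-e(D)} n^{v(D)-|I|},  written as  2^{e(D)} * #copies ≤ n^{v(D)-|I|}
StronglyTournamentAntiSidorenko : (D : Digraph) → Subset (size D) → Set
StronglyTournamentAntiSidorenko D I =
  (n : ℕ) (T : Tournament n) (ϕ : Fin (size D) → Fin n) → InjectiveOn I ϕ →
  2 ^ e D * extCopies D T I ϕ ≤ n ^ (v D ∸ ∣ I ∣)

-- The directed star on 2k+1 vertices: centre fzero; leaves fsuc j.
-- Leaves j with toℕ j < k are in-neighbours (edge leaf → centre),
-- leaves j with toℕ j ≥ k are out-neighbours (edge centre → leaf).

starAdj : (k : ℕ) → Fin (suc (k + k)) → Fin (suc (k + k)) → Bool
starAdj k fzero    fzero    = false
starAdj k fzero    (fsuc j) = not (toℕ j <ᵇ k)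
starAdj k (fsuc i) fzero    = toℕ i <ᵇ k
starAdj k (fsuc i) (fsuc j) = false

starNoLoop : ∀ k x → starAdj k x x ≡ false
starNoLoop k fzero    = Relation.Binary.PropositionalEquality.refl
starNoLoop k (fsuc i) = Relation.Binary.PropositionalEquality.refl

starNoAnti : ∀ k x y → starAdj k x y ≡ true → starAdj k y x ≡ false
starNoAnti k fzero    fzero    ()
starNoAnti k fzero    (fsuc j) p with toℕ j <ᵇ k
... | false = Relation.Binary.PropositionalEquality.refl
starNoAnti k (fsuc i) fzero    p with toℕ i <ᵇ k
... | true = Relation.Binary.PropositionalEquality.refl
starNoAnti k (fsuc i) (fsuc j) ()

star : ℕ → Digraph
star k = record
  { size = suc (k + k) ; adj = starAdj k
  ; noLoop = starNoLoop k ; noAnti = starNoAnti k }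

centre : (k : ℕ) → Subset (suc (k + k))
centre k x = x == fzero

-- A copy of the star extending ϕ sends the centre to u = ϕ(v), each of the k
-- in-leaves into the in-neighbourhood of u and each of the k out-leaves into its
-- out-neighbourhood. Dropping injectivity of the copy therefore bounds the count
-- by a^k b^k, where a and b are the in- and out-degree of u. These neighbourhoods
-- are disjoint, so a + b ≤ n, and AM-GM gives 4ab ≤ n², i.e. 2^(2k) a^k b^k ≤ n^(2k).
module Submission where

open import Defs
open import Data.Nat using (ℕ; zero; suc; _+_; _*_; _∸_; _^_; _≤_; _<ᵇ_; z≤n)
open import Data.Nat.Properties
open import Data.Nat.ListAction using (sum; product)
open import Data.Nat.Tactic.RingSolver using (solve-∀)
open import Algebra.Properties.CommutativeSemigroup +-commutativeSemigroup
  using () renaming (interchange to +-interchange)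
open import Algebra.Properties.CommutativeSemigroup *-commutativeSemigroup
  using () renaming (interchange to *-interchange)
open import Data.Bool using (Bool; true; false; not; _∧_; if_then_else_; T)
open import Data.Bool.Properties using (T?; T-∧)
open import Data.Fin using (Fin; toℕ) renaming (zero to fzero; suc to fsuc)
import Data.Fin as Fin
open import Data.List using (List; []; _∷_; map; concatMap; filter; length; allFin; foldr; tabulate; _++_)
open import Data.List.Properties using (length-++; filter-++; map-tabulate; map-cong; length-tabulate)
open import Data.List.Membership.Propositional using (_∈_)
open import Data.List.Membership.Propositional.Properties using (∈-allFin)
open import Data.List.Relation.Unary.Any using (here; there)
open import Data.Vec using (Vec; lookup) renaming ([] to []ᵛ; _∷_ to _∷ᵛ_)
open import Data.Product using (_,_; proj₁; proj₂)
open import Data.Sum using (inj₁; inj₂)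
open import Data.Unit using (tt)
open import Data.Empty using (⊥; ⊥-elim)
open import Function using (_∘_; id)
open import Function.Bundles using (Equivalence)
open import Relation.Nullary using (yes; no)
open import Relation.Nullary.Decidable using (toWitness; fromWitness; isYes≗does)
open import Relation.Binary.PropositionalEquality

private
  variable
    A B C : Set

T-⇒ᵇ : ∀ {a b} → T (a ⇒ᵇ b) → T a → T b
T-⇒ᵇ {true} b _ = b

T-not-¬ : ∀ {b} → T (not b) → T b → ⊥
T-not-¬ {false} _ ()

T-¬-not : ∀ b → (T b → ⊥) → T (not b)
T-¬-not false _  = tt
T-¬-not true  ¬b = ¬b tt

T-if : ∀ b {x y} → (T b → T x) → (T (not b) → T y) → T (if b then x else y)
T-if true  then _ = then tt
T-if false _ else = else tt

T-foldr-∧ : ∀ (p : A → Bool) xs → T (foldr (λ x b → p x ∧ b) true xs) → ∀ {x} → x ∈ xs → T (p x)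
T-foldr-∧ p (x ∷ xs) h (here refl) = proj₁ (Equivalence.to T-∧ h)
T-foldr-∧ p (x ∷ xs) h (there x∈xs) = T-foldr-∧ p xs (proj₂ (Equivalence.to T-∧ h)) x∈xs

T-allᵇ : ∀ {n} {p : Fin n → Bool} → T (allᵇ p) → ∀ i → T (p i)
T-allᵇ {n} {p} h i = T-foldr-∧ p (allFin n) h (∈-allFin i)

indicator : Bool → ℕ
indicator true  = 1
indicator false = 0

indicator-mono : ∀ {a b} → (T a → T b) → indicator a ≤ indicator b
indicator-mono {false}         _ = z≤n
indicator-mono {true} {true}   _ = ≤-refl
indicator-mono {true} {false} a⇒b = ⊥-elim (a⇒b tt)

indicator-+-not : ∀ b → indicator b + indicator (not b) ≡ 1
indicator-+-not true  = refl
indicator-+-not false = refl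

count : (A → Bool) → List A → ℕ
count p xs = length (filter (T? ∘ p) xs)

count-∷ : ∀ (p : A → Bool) x xs → count p (x ∷ xs) ≡ indicator (p x) + count p xs
count-∷ p x xs with p x
... | true  = refl
... | false = refl

count-++ : ∀ (p : A → Bool) xs ys → count p (xs ++ ys) ≡ count p xs + count p ys
count-++ p xs ys = trans (cong length (filter-++ (T? ∘ p) xs ys)) (length-++ (filter (T? ∘ p) xs))

count-map : ∀ (p : B → Bool) (f : A → B) xs → count p (map f xs) ≡ count (p ∘ f) xs
count-map p f []       = refl
count-map p f (x ∷ xs) = begin
  count p (f x ∷ map f xs)                 ≡⟨ count-∷ p (f x) (map f xs) ⟩
  indicator (p (f x)) + count p (map f xs) ≡⟨ cong (indicator (p (f x)) +_) (count-map p f xs) ⟩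
  indicator (p (f x)) + count (p ∘ f) xs   ≡⟨ count-∷ (p ∘ f) x xs ⟨
  count (p ∘ f) (x ∷ xs)                   ∎
  where open ≡-Reasoning

count-cong : ∀ {p q : A → Bool} → (∀ x → p x ≡ q x) → ∀ xs → count p xs ≡ count q xs
count-cong p≗q []       = refl
count-cong {p = p} {q} p≗q (x ∷ xs) = begin
  count p (x ∷ xs)             ≡⟨ count-∷ p x xs ⟩
  indicator (p x) + count p xs ≡⟨ cong₂ _+_ (cong indicator (p≗q x)) (count-cong p≗q xs) ⟩
  indicator (q x) + count q xs ≡⟨ count-∷ q x xs ⟨
  count q (x ∷ xs)             ∎
  where open ≡-Reasoning

count-false : ∀ (xs : List A) → count (λ _ → false) xs ≡ 0
count-false []       = refl
count-false (_ ∷ xs) = count-false xs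

count-∧ˡ : ∀ b (p : A → Bool) xs → count (λ x → b ∧ p x) xs ≡ indicator b * count p xs
count-∧ˡ true  p xs = sym (+-identityʳ (count p xs))
count-∧ˡ false p xs = count-false xs

count-mono : ∀ {p q : A → Bool} → (∀ x → T (p x) → T (q x)) → ∀ xs → count p xs ≤ count q xs
count-mono p⇒q []       = z≤n
count-mono {p = p} {q} p⇒q (x ∷ xs) = begin
  count p (x ∷ xs)             ≡⟨ count-∷ p x xs ⟩
  indicator (p x) + count p xs ≤⟨ +-mono-≤ (indicator-mono (p⇒q x)) (count-mono p⇒q xs) ⟩
  indicator (q x) + count q xs ≡⟨ count-∷ q x xs ⟨
  count q (x ∷ xs)             ∎
  where open ≤-Reasoning

count-complement : ∀ (p : A → Bool) xs → count p xs + count (not ∘ p) xs ≡ length xs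
count-complement p []       = refl
count-complement p (x ∷ xs) = begin
  count p (x ∷ xs) + count (not ∘ p) (x ∷ xs)
    ≡⟨ cong₂ _+_ (count-∷ p x xs) (count-∷ (not ∘ p) x xs) ⟩
  (indicator (p x) + count p xs) + (indicator (not (p x)) + count (not ∘ p) xs)
    ≡⟨ +-interchange (indicator (p x)) (count p xs) (indicator (not (p x))) (count (not ∘ p) xs) ⟩
  (indicator (p x) + indicator (not (p x))) + (count p xs + count (not ∘ p) xs)
    ≡⟨ cong₂ _+_ (indicator-+-not (p x)) (count-complement p xs) ⟩
  suc (length xs) ∎
  where open ≡-Reasoning

count-disjoint : ∀ {p q : A → Bool} → (∀ x → T (p x) → T (q x) → ⊥) → ∀ xs →
                 count p xs + count q xs ≤ length xs
count-disjoint {p = p} {q} disjoint xs = begin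
  count p xs + count q xs         ≤⟨ +-monoʳ-≤ (count p xs) (count-mono q⇒¬p xs) ⟩
  count p xs + count (not ∘ p) xs ≡⟨ count-complement p xs ⟩
  length xs                       ∎
  where
  open ≤-Reasoning
  q⇒¬p : ∀ x → T (q x) → T (not (p x))
  q⇒¬p x qx = T-¬-not (p x) (λ px → disjoint x px qx)

sum-map-indicator : ∀ (p : A → Bool) xs → sum (map (indicator ∘ p) xs) ≡ count p xs
sum-map-indicator p []       = refl
sum-map-indicator p (x ∷ xs) =
  trans (cong (indicator (p x) +_) (sum-map-indicator p xs)) (sym (count-∷ p x xs))

count-concatMap-map : ∀ (p : A → Bool) (q : B → Bool) (r : C → Bool) (g : A → B → C) →
                      (∀ x y → r (g x y) ≡ p x ∧ q y) → ∀ xs ys →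
                      count r (concatMap (λ x → map (g x) ys) xs) ≡ count p xs * count q ys
count-concatMap-map p q r g r≡p∧q []       ys = refl
count-concatMap-map p q r g r≡p∧q (x ∷ xs) ys = begin
  count r (map (g x) ys ++ concatMap (λ x → map (g x) ys) xs)
    ≡⟨ count-++ r (map (g x) ys) _ ⟩
  count r (map (g x) ys) + count r (concatMap (λ x → map (g x) ys) xs)
    ≡⟨ cong₂ _+_ row (count-concatMap-map p q r g r≡p∧q xs ys) ⟩
  indicator (p x) * count q ys + count p xs * count q ys
    ≡⟨ *-distribʳ-+ (count q ys) (indicator (p x)) (count p xs) ⟨
  (indicator (p x) + count p xs) * count q ys
    ≡⟨ cong (_* count q ys) (count-∷ p x xs) ⟨
  count p (x ∷ xs) * count q ys ∎
  where
  open ≡-Reasoning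
  row : count r (map (g x) ys) ≡ indicator (p x) * count q ys
  row = begin
    count r (map (g x) ys)      ≡⟨ count-map r (g x) ys ⟩
    count (r ∘ g x) ys          ≡⟨ count-cong (r≡p∧q x) ys ⟩
    count (λ y → p x ∧ q y) ys  ≡⟨ count-∧ˡ (p x) q ys ⟩
    indicator (p x) * count q ys ∎

map-allFin-suc : ∀ {n} (f : Fin (suc n) → A) → map f (allFin (suc n)) ≡ f fzero ∷ map (f ∘ fsuc) (allFin n)
map-allFin-suc f =
  cong (f fzero ∷_) (trans (map-tabulate fsuc f) (sym (map-tabulate id (f ∘ fsuc))))

countᵇ-suc : ∀ {n} (p : Fin (suc n) → Bool) → countᵇ p ≡ indicator (p fzero) + countᵇ (p ∘ fsuc)
countᵇ-suc {n} p = begin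
  count p (fzero ∷ tabulate fsuc)
    ≡⟨ count-∷ p fzero (tabulate fsuc) ⟩
  indicator (p fzero) + count p (tabulate fsuc)
    ≡⟨ cong (λ xs → indicator (p fzero) + count p xs) (map-tabulate id fsuc) ⟨
  indicator (p fzero) + count p (map fsuc (allFin n))
    ≡⟨ cong (indicator (p fzero) +_) (count-map p fsuc (allFin n)) ⟩
  indicator (p fzero) + countᵇ (p ∘ fsuc) ∎
  where open ≡-Reasoning

==-suc : ∀ {n} (x y : Fin n) → (fsuc x == fsuc y) ≡ (x == y)
==-suc x y = trans (isYes≗does (fsuc x Fin.≟ fsuc y)) (sym (isYes≗does (x Fin.≟ y)))

countᵇ-== : ∀ {n} (u : Fin n) → countᵇ (λ y → y == u) ≡ 1
countᵇ-== {suc n} fzero    = trans (countᵇ-suc {n} (λ y → y == fzero)) (cong suc (count-false (allFin n)))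
countᵇ-== {suc n} (fsuc u) = begin
  countᵇ (λ y → y == fsuc u)        ≡⟨ countᵇ-suc (λ y → y == fsuc u) ⟩
  countᵇ (λ y → fsuc y == fsuc u)   ≡⟨ count-cong (λ y → ==-suc y u) (allFin n) ⟩
  countᵇ (λ y → y == u)             ≡⟨ countᵇ-== u ⟩
  1                                 ∎
  where open ≡-Reasoning

product-map-const : ∀ (b : ℕ) (xs : List A) → product (map (λ _ → b) xs) ≡ b ^ length xs
product-map-const b []       = refl
product-map-const b (_ ∷ xs) = cong (b *_) (product-map-const b xs)

product-threshold : ∀ c d a b →
  product (map (λ i → if toℕ i <ᵇ c then a else b) (allFin (c + d))) ≡ a ^ c * b ^ d
product-threshold zero d a b = begin
  product (map (λ _ → b) (allFin d)) ≡⟨ product-map-const b (allFin d) ⟩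
  b ^ length (allFin d)             ≡⟨ cong (b ^_) (length-tabulate {n = d} id) ⟩
  b ^ d                             ≡⟨ *-identityˡ (b ^ d) ⟨
  1 * b ^ d                         ∎
  where open ≡-Reasoning
product-threshold (suc c) d a b = begin
  product (map f (allFin (suc (c + d))))
    ≡⟨ cong product (map-allFin-suc f) ⟩
  a * product (map (f ∘ fsuc) (allFin (c + d)))
    ≡⟨ cong (a *_) (product-threshold c d a b) ⟩
  a * (a ^ c * b ^ d)
    ≡⟨ *-assoc a (a ^ c) (b ^ d) ⟨
  a ^ suc c * b ^ d ∎
  where
  open ≡-Reasoning
  f : Fin (suc (c + d)) → ℕ
  f i = if toℕ i <ᵇ suc c then a else b

allAtᵇ : ∀ {m n} → (Fin m → Fin n → Bool) → Vec (Fin n) m → Bool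
allAtᵇ ps []ᵛ        = true
allAtᵇ ps (x ∷ᵛ xs) = ps fzero x ∧ allAtᵇ (ps ∘ fsuc) xs

allAtᵇ-intro : ∀ {m n} (ps : Fin m → Fin n → Bool) (xs : Vec (Fin n) m) →
               (∀ i → T (ps i (lookup xs i))) → T (allAtᵇ ps xs)
allAtᵇ-intro ps []ᵛ        h = tt
allAtᵇ-intro ps (x ∷ᵛ xs) h =
  Equivalence.from T-∧ (h fzero , allAtᵇ-intro (ps ∘ fsuc) xs (h ∘ fsuc))

count-allMaps : ∀ m n (ps : Fin m → Fin n → Bool) →
                count (allAtᵇ ps) (allMaps m n) ≡ product (map (countᵇ ∘ ps) (allFin m))
count-allMaps zero    n ps = refl
count-allMaps (suc m) n ps = begin
  count (allAtᵇ ps) (concatMap (λ x → map (x ∷ᵛ_) (allMaps m n)) (allFin n))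
    ≡⟨ count-concatMap-map (ps fzero) (allAtᵇ (ps ∘ fsuc)) (allAtᵇ ps) _∷ᵛ_
         (λ _ _ → refl) (allFin n) (allMaps m n) ⟩
  countᵇ (ps fzero) * count (allAtᵇ (ps ∘ fsuc)) (allMaps m n)
    ≡⟨ cong (countᵇ (ps fzero) *_) (count-allMaps m n (ps ∘ fsuc)) ⟩
  countᵇ (ps fzero) * product (map (countᵇ ∘ ps ∘ fsuc) (allFin m))
    ≡⟨ cong product (map-allFin-suc (countᵇ ∘ ps)) ⟨
  product (map (countᵇ ∘ ps) (allFin (suc m))) ∎
  where open ≡-Reasoning

^-distribʳ-* : ∀ x y k → (x * y) ^ k ≡ x ^ k * y ^ k
^-distribʳ-* x y zero    = refl
^-distribʳ-* x y (suc k) = trans (cong (x * y *_) (^-distribʳ-* x y k)) (*-interchange x y (x ^ k) (y ^ k))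

square-of-sum : ∀ a d → (a + (a + d)) * (a + (a + d)) ≡ 4 * (a * (a + d)) + d * d
square-of-sum = solve-∀

am-gm-ordered : ∀ {a b} → a ≤ b → 4 * (a * b) ≤ (a + b) * (a + b)
am-gm-ordered {a} a≤b with d , refl ← m≤n⇒∃[o]m+o≡n a≤b =
  ≤-trans (m≤m+n (4 * (a * (a + d))) (d * d)) (≤-reflexive (sym (square-of-sum a d)))

am-gm : ∀ a b → 4 * (a * b) ≤ (a + b) * (a + b)
am-gm a b with ≤-total a b
... | inj₁ a≤b = am-gm-ordered a≤b
... | inj₂ b≤a = subst₂ (λ x y → 4 * x ≤ y * y) (*-comm b a) (+-comm b a) (am-gm-ordered b≤a)

am-gm-power : ∀ k {a b n} → a + b ≤ n → 2 ^ (k + k) * (a ^ k * b ^ k) ≤ n ^ (k + k)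
am-gm-power k {a} {b} {n} a+b≤n = begin
  2 ^ (k + k) * (a ^ k * b ^ k)
    ≡⟨ cong₂ _*_ (trans (^-distribˡ-+-* 2 k k) (sym (^-distribʳ-* 2 2 k))) (sym (^-distribʳ-* a b k)) ⟩
  4 ^ k * (a * b) ^ k
    ≡⟨ ^-distribʳ-* 4 (a * b) k ⟨
  (4 * (a * b)) ^ k
    ≤⟨ ^-monoˡ-≤ k (≤-trans (am-gm a b) (*-mono-≤ a+b≤n a+b≤n)) ⟩
  (n * n) ^ k
    ≡⟨ trans (^-distribʳ-* n n k) (sym (^-distribˡ-+-* n k k)) ⟩
  n ^ (k + k) ∎
  where open ≤-Reasoning

arc-asym : ∀ {n} (Tr : Tournament n) {x y} → T (arc Tr x y) → T (arc Tr y x) → ⊥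
arc-asym Tr {x} {y} xy yx with x Fin.≟ y
... | yes refl = subst T (irrefl Tr x) xy
... | no x≢y   = T-not-¬ (subst T (complete Tr x y x≢y) xy) yx

inDegree : ∀ {n} → Tournament n → Fin n → ℕ
inDegree Tr u = countᵇ (λ y → arc Tr y u)

outDegree : ∀ {n} → Tournament n → Fin n → ℕ
outDegree Tr u = countᵇ (arc Tr u)

inDegree+outDegree≤n : ∀ {n} (Tr : Tournament n) u → inDegree Tr u + outDegree Tr u ≤ n
inDegree+outDegree≤n {n} Tr u = begin
  inDegree Tr u + outDegree Tr u ≤⟨ count-disjoint (λ y → arc-asym Tr) (allFin n) ⟩
  length (allFin n)              ≡⟨ length-tabulate id ⟩
  n                              ∎
  where open ≤-Reasoning

module _ (D : Digraph) {n} (Tr : Tournament n) (I : Subset (size D)) (ϕ φ : Fin (size D) → Fin n)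
         (copy : T (isExtCopyᵇ D Tr I ϕ φ)) where

  private
    Edges Extends : Bool
    Edges   = allᵇ (λ x → allᵇ (λ y → adj D x y ⇒ᵇ arc Tr (φ x) (φ y)))
    Extends = allᵇ (λ x → I x ⇒ᵇ (φ x == ϕ x))

    edges-extends : T (Edges ∧ Extends)
    edges-extends = proj₂ (Equivalence.to (T-∧ {injectiveOnᵇ (λ _ → true) φ}) copy)

    edges : T Edges
    edges = proj₁ (Equivalence.to (T-∧ {Edges}) edges-extends)

    extends : T Extends
    extends = proj₂ (Equivalence.to (T-∧ {Edges}) edges-extends)

  extCopy-edge : ∀ x y → T (adj D x y) → T (arc Tr (φ x) (φ y))
  extCopy-edge x y = T-⇒ᵇ (T-allᵇ (T-allᵇ edges x) y)

  extCopy-extends : ∀ x → T (I x) → φ x ≡ ϕ x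
  extCopy-extends x Ix = toWitness (T-⇒ᵇ (T-allᵇ extends x) Ix)

e-star : ∀ k → e (star k) ≡ k + k
e-star k = begin
  e (star k)
    ≡⟨ cong sum (map-allFin-suc (countᵇ ∘ starAdj k)) ⟩
  countᵇ (starAdj k fzero) + sum (map (countᵇ ∘ starAdj k ∘ fsuc) (allFin (k + k)))
    ≡⟨ cong₂ _+_ (countᵇ-suc (starAdj k fzero)) (cong sum (map-cong leaf-outdegree (allFin (k + k)))) ⟩
  countᵇ (not ∘ isIn) + sum (map (indicator ∘ isIn) (allFin (k + k)))
    ≡⟨ cong (countᵇ (not ∘ isIn) +_) (sum-map-indicator isIn (allFin (k + k))) ⟩
  countᵇ (not ∘ isIn) + countᵇ isIn
    ≡⟨ +-comm (countᵇ (not ∘ isIn)) (countᵇ isIn) ⟩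
  countᵇ isIn + countᵇ (not ∘ isIn)
    ≡⟨ count-complement isIn (allFin (k + k)) ⟩
  length (allFin (k + k))
    ≡⟨ length-tabulate {n = k + k} id ⟩
  k + k ∎
  where
  open ≡-Reasoning
  isIn : Fin (k + k) → Bool
  isIn j = toℕ j <ᵇ k
  leaf-outdegree : ∀ j → countᵇ (starAdj k (fsuc j)) ≡ indicator (isIn j)
  leaf-outdegree j = begin
    countᵇ (starAdj k (fsuc j))
      ≡⟨ countᵇ-suc (starAdj k (fsuc j)) ⟩
    indicator (isIn j) + countᵇ {k + k} (λ _ → false)
      ≡⟨ cong (indicator (isIn j) +_) (count-false (allFin (k + k))) ⟩
    indicator (isIn j) + 0
      ≡⟨ +-identityʳ (indicator (isIn j)) ⟩
    indicator (isIn j) ∎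

centre-size : ∀ k → ∣ centre k ∣ ≡ 1
centre-size k = countᵇ-== {suc (k + k)} fzero

admissibleᵇ : ∀ k {n} → Tournament n → Fin n → Fin (suc (k + k)) → Fin n → Bool
admissibleᵇ k Tr u fzero    y = y == u
admissibleᵇ k Tr u (fsuc j) y = if toℕ j <ᵇ k then arc Tr y u else arc Tr u y

star-copy-admissible : ∀ k {n} (Tr : Tournament n) (ϕ φ : Fin (suc (k + k)) → Fin n) →
                       T (isExtCopyᵇ (star k) Tr (centre k) ϕ φ) →
                       ∀ i → T (admissibleᵇ k Tr (ϕ fzero) i (φ i))
star-copy-admissible k Tr ϕ φ copy = admissible
  where
  edge : ∀ x y → T (starAdj k x y) → T (arc Tr (φ x) (φ y))
  edge = extCopy-edge (star k) Tr (centre k) ϕ φ copy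
  centre↦ϕ : φ fzero ≡ ϕ fzero
  centre↦ϕ = extCopy-extends (star k) Tr (centre k) ϕ φ copy fzero tt
  admissible : ∀ i → T (admissibleᵇ k Tr (ϕ fzero) i (φ i))
  admissible fzero    = fromWitness centre↦ϕ
  admissible (fsuc j) = T-if (toℕ j <ᵇ k)
    (λ inLeaf  → subst (λ w → T (arc Tr (φ (fsuc j)) w)) centre↦ϕ (edge (fsuc j) fzero inLeaf))
    (λ outLeaf → subst (λ w → T (arc Tr w (φ (fsuc j)))) centre↦ϕ (edge fzero (fsuc j) outLeaf))

admissible-count : ∀ k {n} (Tr : Tournament n) u →
                   product (map (countᵇ ∘ admissibleᵇ k Tr u) (allFin (suc (k + k))))
                   ≡ inDegree Tr u ^ k * outDegree Tr u ^ k
admissible-count k Tr u = begin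
  product (map (countᵇ ∘ admissibleᵇ k Tr u) (allFin (suc (k + k))))
    ≡⟨ cong product (map-allFin-suc (countᵇ ∘ admissibleᵇ k Tr u)) ⟩
  countᵇ (λ y → y == u) * product (map (countᵇ ∘ admissibleᵇ k Tr u ∘ fsuc) (allFin (k + k)))
    ≡⟨ cong₂ _*_ (countᵇ-== u) (cong product (map-cong leaf-count (allFin (k + k)))) ⟩
  1 * product (map (λ j → if toℕ j <ᵇ k then inDegree Tr u else outDegree Tr u) (allFin (k + k)))
    ≡⟨ *-identityˡ _ ⟩
  product (map (λ j → if toℕ j <ᵇ k then inDegree Tr u else outDegree Tr u) (allFin (k + k)))
    ≡⟨ product-threshold k k (inDegree Tr u) (outDegree Tr u) ⟩
  inDegree Tr u ^ k * outDegree Tr u ^ k ∎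
  where
  open ≡-Reasoning
  leaf-count : ∀ j → countᵇ (admissibleᵇ k Tr u (fsuc j))
                     ≡ (if toℕ j <ᵇ k then inDegree Tr u else outDegree Tr u)
  leaf-count j with toℕ j <ᵇ k
  ... | true  = refl
  ... | false = refl

star-copies-bound : ∀ k {n} (Tr : Tournament n) ϕ →
                    extCopies (star k) Tr (centre k) ϕ ≤ inDegree Tr (ϕ fzero) ^ k * outDegree Tr (ϕ fzero) ^ k
star-copies-bound k {n} Tr ϕ = begin
  extCopies (star k) Tr (centre k) ϕ
    ≤⟨ count-mono (λ φ copy → allAtᵇ-intro (admissibleᵇ k Tr u) φ
                                 (star-copy-admissible k Tr ϕ (lookup φ) copy))
                  (allMaps (suc (k + k)) n) ⟩
  count (allAtᵇ (admissibleᵇ k Tr u)) (allMaps (suc (k + k)) n)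
    ≡⟨ count-allMaps (suc (k + k)) n (admissibleᵇ k Tr u) ⟩
  product (map (countᵇ ∘ admissibleᵇ k Tr u) (allFin (suc (k + k))))
    ≡⟨ admissible-count k Tr u ⟩
  inDegree Tr u ^ k * outDegree Tr u ^ k ∎
  where
  open ≤-Reasoning
  u : Fin n
  u = ϕ fzero

proposition5p1 : (k : ℕ) → StronglyTournamentAntiSidorenko (star k) (centre k)
-- The injectivity hypothesis is vacuous on the singleton {v}; the bound holds for every ϕ.
proposition5p1 k n Tr ϕ _ = begin
  2 ^ e (star k) * extCopies (star k) Tr (centre k) ϕ
    ≡⟨ cong (λ m → 2 ^ m * extCopies (star k) Tr (centre k) ϕ) (e-star k) ⟩
  2 ^ (k + k) * extCopies (star k) Tr (centre k) ϕ
    ≤⟨ *-monoʳ-≤ (2 ^ (k + k)) (star-copies-bound k Tr ϕ) ⟩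
  2 ^ (k + k) * (inDegree Tr u ^ k * outDegree Tr u ^ k)
    ≤⟨ am-gm-power k (inDegree+outDegree≤n Tr u) ⟩
  n ^ (k + k)
    ≡⟨ cong (λ c → n ^ (suc (k + k) ∸ c)) (centre-size k) ⟨
  n ^ (v (star k) ∸ ∣ centre k ∣) ∎
  where
  open ≤-Reasoning
  u : Fin n
  u = ϕ fzero
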